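{- Let $p,q,n\ge 1$ be integers. Let $K_{p,q}$ be the complete bipartite graph with parts $P$ ($|P|=p$) and $Q$ ($|Q|=q$), and let $K_{p, q}\circ_{1}K_{1,n}$ be the graph obtained by identifying a vertex $a\in P$ with the center of the star $K_{1,n}$; let $N$ denote the set of the $n$ pendant vertices of the star. Then the resistance distances $r_{ij}$ in $K_{p, q}\circ_{1}K_{1,n}$ are: $r(a,x)=\frac{2}{q}$ for $x\in P\setminus\{a\}$; $r(a,y)=\frac{p+q-1}{pq}$ for $y\in Q$; $r(a,z)=1$ for $z\in N$; $r(x,x')=\frac{2}{q}$ for distinct $x,x'\in P\setminus\{a\}$; $r(x,y)=\frac{p+q-1}{pq}$ for $x\in P\setminus\{a\}$, $y\in Q$; $r(x,z)=\frac{q+2}{q}$ for $x\in P\setminus\{a\}$, $z\in N$; $r(y,y')=\frac{2}{p}$ for distinct $y,y'\in Q$; $r(y,z)=\frac{q(p+1)+(p-1)}{pq}$ for $y\in Q$, $z\in N$; $r(z,z')=2$ for distinct $z,z'\in N$.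
   Context: The resistance distance between vertices of a connected graph is the effective resistance between them when every edge is a resistor of $1\Omega$; equivalently $r_{ij}=l^{\#}_{ii}+l^{\#}_{jj}-2l^{\#}_{ij}$ with $L^{\#}$ the group inverse of the Laplacian $L=D-A$. -}

module Defs where

open import Data.Nat as ℕ using (ℕ; zero; suc; _≤_; _<_; NonZero)
open import Data.Nat.Properties using (m*n≢0)
open import Data.Fin using (Fin; toℕ; _≟_) renaming (zero to fzero; suc to fsuc)
open import Data.Bool using (Bool; true; false; if_then_else_; _∧_; _∨_; not)
open import Data.Product using (_×_)
open import Data.Integer using (+_)
open import Data.Rational using (ℚ; 0ℚ; 1ℚ; _+_; _-_; _*_; _/_)
open import Relation.Nullary.Decidable using (⌊_⌋)
open import Relation.Binary.PropositionalEquality using (_≡_)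

Σ : ∀ {m} → (Fin m → ℚ) → ℚ
Σ {zero}  f = 0ℚ
Σ {suc m} f = f fzero + Σ (λ k → f (fsuc k))

Matrix : ℕ → Set
Matrix m = Fin m → Fin m → ℚ

_⊗_ : ∀ {m} → Matrix m → Matrix m → Matrix m
(A ⊗ B) i j = Σ (λ k → A i k * B k j)

IsGroupInverse : ∀ {m} → Matrix m → Matrix m → Set
IsGroupInverse L X =
  (∀ i j → ((L ⊗ X) ⊗ L) i j ≡ L i j) × ((∀ i j → ((X ⊗ L) ⊗ X) i j ≡ X i j) × (∀ i j → (L ⊗ X) i j ≡ (X ⊗ L) i j))

resist : ∀ {m} → Matrix m → Fin m → Fin m → ℚ
resist X i j = X i i + X j j - (+ 2 / 1) * X i j

-- The graph K_{p,q} ∘₁ K_{1,n} on vertex set Fin (p + q + n):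
--   indices 0 .. p-1        : the part P, with a = vertex 0
--   indices p .. p+q-1      : the part Q
--   indices p+q .. p+q+n-1  : the pendant vertices N of the star (centre a)
module Graph (p q n : ℕ) where
  V : ℕ
  V = p ℕ.+ q ℕ.+ n

  isP isQ isN isA : Fin V → Bool
  isP i = toℕ i ℕ.<ᵇ p
  isQ i = not (toℕ i ℕ.<ᵇ p) ∧ (toℕ i ℕ.<ᵇ p ℕ.+ q)
  isN i = not (toℕ i ℕ.<ᵇ p ℕ.+ q)
  isA i = toℕ i ℕ.≡ᵇ 0

  adj : Fin V → Fin V → Bool
  adj i j = (isP i ∧ isQ j) ∨ (isQ i ∧ isP j) ∨ (isA i ∧ isN j) ∨ (isN i ∧ isA j)

  b2q : Bool → ℚ
  b2q true = 1ℚ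
  b2q false = 0ℚ

  deg : Fin V → ℚ
  deg i = Σ (λ k → b2q (adj i k))

  Lap : Matrix V
  Lap i j = (if ⌊ i ≟ j ⌋ then deg i else 0ℚ) - b2q (adj i j)

  A' P' Q' N' : Fin V → Set
  A' i = toℕ i ≡ 0
  P' i = 1 ≤ toℕ i × toℕ i < p
  Q' i = p ≤ toℕ i × toℕ i < p ℕ.+ q
  N' i = p ℕ.+ q ≤ toℕ i

_/[_*_] : ℕ → (p q : ℕ) → .{{NonZero p}} → .{{NonZero q}} → ℚ
k /[ p * q ] = _/_ (+ k) (p ℕ.* q) {{m*n≢0 p q}}

{-# OPTIONS --safe #-}
module Submission where

-- If L is a graph Laplacian and a symmetric matrix R with zero diagonal satisfies
-- L R = τ 1ᵀ − 2 I for some vector τ, then X = −½ Π R Π, with Π = I − J/|V| the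
-- centring projection, satisfies L X = X L = Π. Hence X is the group inverse of L
-- (group inverses are unique in any semigroup), and its resistances
-- x_ii + x_jj − 2 x_ij are exactly the entries of R.
-- In K_{p,q} ∘₁ K_{1,n} everything is constant on the four parts {a}, P ∖ {a}, Q, N,
-- so for the claimed table R the identity L R = τ 1ᵀ − 2 I comes down to fifteen
-- identities between polynomials in p, q, n (after scaling R by pq), which are
-- checked by normalising both sides.

open import Defs
open import Algebra.Bundles using (Semigroup)
open import Data.Bool using (Bool; true; false; if_then_else_; _∧_; _∨_; not)
open import Data.Bool.Properties using (T-≡; ¬-not)
open import Data.Empty using (⊥-elim; ⊥-elim-irr)
open import Data.Fin using (Fin; toℕ) renaming (zero to 0F; suc to 1+)
open import Data.Fin.Properties using (_≟_; toℕ<n; toℕ-injective)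
open import Data.Integer as ℤ using (+_)
import Data.Integer.Properties as ℤ
open import Data.Integer.Tactic.RingSolver using (solve-∀)
open import Data.Nat as ℕ using (ℕ; zero; suc; NonZero; _∸_) renaming (_+_ to _+ℕ_; _*_ to _*ℕ_)
import Data.Nat.Properties as ℕ
open import Data.Product using (_×_; _,_; ∃; proj₁; proj₂)
open import Data.Rational using (ℚ; 0ℚ; 1ℚ; ½; -½; _+_; _*_; _-_; _/_; 1/_; toℚᵘ) renaming (NonZero to NonZeroℚ)
open import Data.Rational.Properties
  using (toℚᵘ-injective; toℚᵘ-fromℚᵘ; toℚᵘ-homo-+; toℚᵘ-homo-*; normalize-pos; pos⇒nonZero; *-inverseʳ;
         +-identityˡ; +-assoc; *-assoc; *-comm; *-identityˡ; *-identityʳ; *-zeroˡ; *-zeroʳ)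
open import Data.Rational.Solver using (module +-*-Solver)
open import Data.Rational.Unnormalised as ℚᵘ using (mkℚᵘ; *≡*) renaming (_≃_ to _≃ᵘ_)
import Data.Rational.Unnormalised.Properties as ℚᵘ
open import Data.Vec using (Vec; _∷_; [])
open import Function.Bundles using (Equivalence)
open import Level using (0ℓ)
open import Relation.Binary.PropositionalEquality using (_≡_; _≢_; refl; sym; trans; cong; cong₂; module ≡-Reasoning)
open import Relation.Nullary using (¬_)
open import Relation.Nullary.Decidable using (Dec; ⌊_⌋; yes; no; ⌊⌋-map′; isYes≗does; dec-true; dec-false)

open +-*-Solver

fromℕ : ℕ → ℚ
fromℕ k = + k / 1

fromℕ-suc-nonZero : ∀ k → NonZeroℚ (fromℕ (suc k))
fromℕ-suc-nonZero k = pos⇒nonZero (fromℕ (suc k)) {{normalize-pos (suc k) 1}}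

toℚᵘ-/ : ∀ k d → toℚᵘ (+ k / suc d) ≃ᵘ mkℚᵘ (+ k) d
toℚᵘ-/ k d = toℚᵘ-fromℚᵘ (mkℚᵘ (+ k) d)

fromℕ-+ : ∀ m n → fromℕ (m +ℕ n) ≡ fromℕ m + fromℕ n
fromℕ-+ m n = toℚᵘ-injective (begin
  toℚᵘ (fromℕ (m +ℕ n))                  ≈⟨ toℚᵘ-/ (m +ℕ n) 0 ⟩
  mkℚᵘ (+ (m +ℕ n)) 0                    ≈⟨ *≡* (trans (cong (ℤ._* + 1) (ℤ.pos-+ m n)) (sum-identity (+ m) (+ n))) ⟩
  mkℚᵘ (+ m) 0 ℚᵘ.+ mkℚᵘ (+ n) 0         ≈⟨ ℚᵘ.+-cong (toℚᵘ-/ m 0) (toℚᵘ-/ n 0) ⟨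
  toℚᵘ (fromℕ m) ℚᵘ.+ toℚᵘ (fromℕ n)     ≈⟨ toℚᵘ-homo-+ (fromℕ m) (fromℕ n) ⟨
  toℚᵘ (fromℕ m + fromℕ n)               ∎)
  where
  open ℚᵘ.≃-Reasoning
  sum-identity : ∀ x y → (x ℤ.+ y) ℤ.* + 1 ≡ (x ℤ.* + 1 ℤ.+ y ℤ.* + 1) ℤ.* + 1
  sum-identity = solve-∀

fromℕ-* : ∀ m n → fromℕ (m *ℕ n) ≡ fromℕ m * fromℕ n
fromℕ-* m n = toℚᵘ-injective (begin
  toℚᵘ (fromℕ (m *ℕ n))                  ≈⟨ toℚᵘ-/ (m *ℕ n) 0 ⟩
  mkℚᵘ (+ (m *ℕ n)) 0                    ≈⟨ *≡* (cong (ℤ._* + 1) (ℤ.pos-* m n)) ⟩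
  mkℚᵘ (+ m) 0 ℚᵘ.* mkℚᵘ (+ n) 0         ≈⟨ ℚᵘ.*-cong (toℚᵘ-/ m 0) (toℚᵘ-/ n 0) ⟨
  toℚᵘ (fromℕ m) ℚᵘ.* toℚᵘ (fromℕ n)     ≈⟨ toℚᵘ-homo-* (fromℕ m) (fromℕ n) ⟨
  toℚᵘ (fromℕ m * fromℕ n)               ∎)
  where open ℚᵘ.≃-Reasoning

/-*-denominator : ∀ k d → (+ k / suc d) * fromℕ (suc d) ≡ fromℕ k
/-*-denominator k d = toℚᵘ-injective (begin
  toℚᵘ ((+ k / suc d) * fromℕ (suc d))          ≈⟨ toℚᵘ-homo-* (+ k / suc d) (fromℕ (suc d)) ⟩
  toℚᵘ (+ k / suc d) ℚᵘ.* toℚᵘ (fromℕ (suc d))  ≈⟨ ℚᵘ.*-cong (toℚᵘ-/ k d) (toℚᵘ-/ (suc d) 0) ⟩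
  mkℚᵘ (+ k) d ℚᵘ.* mkℚᵘ (+ suc d) 0           ≈⟨ *≡* (trans (ℤ.*-identityʳ _) (cong (λ e → + k ℤ.* + suc e) (sym (ℕ.*-identityʳ d)))) ⟩
  mkℚᵘ (+ k) 0                                 ≈⟨ toℚᵘ-/ k 0 ⟨
  toℚᵘ (fromℕ k)                               ∎)
  where open ℚᵘ.≃-Reasoning

*-cancelʳ-invertible : ∀ {x y d e} → d * e ≡ 1ℚ → x * d ≡ y * d → x ≡ y
*-cancelʳ-invertible {x} {y} {d} {e} de≡1 xd≡yd = begin
  x            ≡⟨ sym (*-identityʳ x) ⟩
  x * 1ℚ       ≡⟨ cong (x *_) (sym de≡1) ⟩
  x * (d * e)  ≡⟨ sym (*-assoc x d e) ⟩
  x * d * e    ≡⟨ cong (_* e) xd≡yd ⟩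
  y * d * e    ≡⟨ *-assoc y d e ⟩
  y * (d * e)  ≡⟨ cong (y *_) de≡1 ⟩
  y * 1ℚ       ≡⟨ *-identityʳ y ⟩
  y            ∎
  where open ≡-Reasoning

1/fromℕ-suc : ℕ → ℚ
1/fromℕ-suc d = (1/ fromℕ (suc d)) {{fromℕ-suc-nonZero d}}

fromℕ-suc-*-inverse : ∀ d → fromℕ (suc d) * 1/fromℕ-suc d ≡ 1ℚ
fromℕ-suc-*-inverse d = *-inverseʳ (fromℕ (suc d)) {{fromℕ-suc-nonZero d}}

/-unique : ∀ k d x → x * fromℕ (suc d) ≡ fromℕ k → x ≡ + k / suc d
/-unique k d x eq = *-cancelʳ-invertible (fromℕ-suc-*-inverse d) (trans eq (sym (/-*-denominator k d)))

Σ-cong : ∀ {m} {f g : Fin m → ℚ} → (∀ k → f k ≡ g k) → Σ f ≡ Σ g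
Σ-cong {zero}  f≗g = refl
Σ-cong {suc m} f≗g = cong₂ _+_ (f≗g 0F) (Σ-cong (λ k → f≗g (1+ k)))

Σ-+ : ∀ {m} (f g : Fin m → ℚ) → Σ (λ k → f k + g k) ≡ Σ f + Σ g
Σ-+ {zero}  f g = refl
Σ-+ {suc m} f g = trans (cong (_+_ (f 0F + g 0F)) (Σ-+ (λ k → f (1+ k)) (λ k → g (1+ k))))
  (solve 4 (λ a b c d → (a :+ b) :+ (c :+ d) := (a :+ c) :+ (b :+ d)) refl (f 0F) (g 0F) (Σ (λ k → f (1+ k))) (Σ (λ k → g (1+ k))))

Σ-*ˡ : ∀ {m} c (f : Fin m → ℚ) → Σ (λ k → c * f k) ≡ c * Σ f
Σ-*ˡ {zero}  c f = sym (*-zeroʳ c)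
Σ-*ˡ {suc m} c f = trans (cong (_+_ (c * f 0F)) (Σ-*ˡ c (λ k → f (1+ k))))
  (solve 3 (λ c a b → c :* a :+ c :* b := c :* (a :+ b)) refl c (f 0F) (Σ (λ k → f (1+ k))))

Σ-− : ∀ {m} (f g : Fin m → ℚ) → Σ (λ k → f k - g k) ≡ Σ f - Σ g
Σ-− {zero}  f g = refl
Σ-− {suc m} f g = trans (cong (_+_ (f 0F - g 0F)) (Σ-− (λ k → f (1+ k)) (λ k → g (1+ k))))
  (solve 4 (λ a b c d → (a :- b) :+ (c :- d) := (a :+ c) :- (b :+ d)) refl (f 0F) (g 0F) (Σ (λ k → f (1+ k))) (Σ (λ k → g (1+ k))))

Σ-const : ∀ m c → Σ {m} (λ _ → c) ≡ fromℕ m * c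
Σ-const zero    c = sym (*-zeroˡ c)
Σ-const (suc m) c = begin
  c + Σ {m} (λ _ → c)       ≡⟨ cong (_+_ c) (Σ-const m c) ⟩
  c + fromℕ m * c           ≡⟨ solve 2 (λ c x → c :+ x :* c := (con 1ℚ :+ x) :* c) refl c (fromℕ m) ⟩
  (1ℚ + fromℕ m) * c        ≡⟨ cong (_* c) (sym (fromℕ-+ 1 m)) ⟩
  fromℕ (suc m) * c         ∎
  where open ≡-Reasoning

Σ-linear : ∀ {m} a b c (f g h : Fin m → ℚ) →
           Σ (λ k → a * f k + b * g k + c * h k) ≡ a * Σ f + b * Σ g + c * Σ h
Σ-linear a b c f g h = begin
  Σ (λ k → a * f k + b * g k + c * h k)                     ≡⟨ Σ-+ (λ k → a * f k + b * g k) (λ k → c * h k) ⟩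
  Σ (λ k → a * f k + b * g k) + Σ (λ k → c * h k)           ≡⟨ cong₂ _+_ (Σ-+ (λ k → a * f k) (λ k → b * g k)) (Σ-*ˡ c h) ⟩
  Σ (λ k → a * f k) + Σ (λ k → b * g k) + c * Σ h           ≡⟨ cong₂ (λ u v → u + v + c * Σ h) (Σ-*ˡ a f) (Σ-*ˡ b g) ⟩
  a * Σ f + b * Σ g + c * Σ h                               ∎
  where open ≡-Reasoning

Σ-constant : ∀ {m} (f : Fin m → ℚ) c → (∀ k → f k ≡ c) → Σ f ≡ fromℕ m * c
Σ-constant {m} f c f≡c = trans (Σ-cong f≡c) (Σ-const m c)

Σ-split : ∀ m k (h : ℕ → ℚ) → Σ {m +ℕ k} (λ i → h (toℕ i)) ≡ Σ {m} (λ i → h (toℕ i)) + Σ {k} (λ i → h (m +ℕ toℕ i))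
Σ-split zero    k h = sym (+-identityˡ _)
Σ-split (suc m) k h = trans (cong (_+_ (h 0)) (Σ-split m k (λ x → h (suc x))))
                            (sym (+-assoc (h 0) (Σ {m} (λ i → h (suc (toℕ i)))) (Σ {k} (λ i → h (suc m +ℕ toℕ i)))))

Σ-comm : ∀ {m n} (f : Fin m → Fin n → ℚ) → Σ (λ i → Σ (λ j → f i j)) ≡ Σ (λ j → Σ (λ i → f i j))
Σ-comm {zero}  {n} f = sym (trans (Σ-const n 0ℚ) (*-zeroʳ (fromℕ n)))
Σ-comm {suc m} f = trans (cong (_+_ (Σ (f 0F))) (Σ-comm (λ i → f (1+ i)))) (sym (Σ-+ (f 0F) _))

δ : ∀ {m} → Fin m → Fin m → ℚ
δ i j = if ⌊ i ≟ j ⌋ then 1ℚ else 0ℚ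

⌊≟⌋-refl : ∀ {m} (i : Fin m) → ⌊ i ≟ i ⌋ ≡ true
⌊≟⌋-refl i = trans (isYes≗does (i ≟ i)) (dec-true (i ≟ i) refl)

⌊≟⌋-≢ : ∀ {m} {i j : Fin m} → i ≢ j → ⌊ i ≟ j ⌋ ≡ false
⌊≟⌋-≢ {i = i} {j} i≢j = trans (isYes≗does (i ≟ j)) (dec-false (i ≟ j) i≢j)

⌊≟⌋-sym : ∀ {m} (i j : Fin m) → ⌊ i ≟ j ⌋ ≡ ⌊ j ≟ i ⌋
⌊≟⌋-sym i j with i ≟ j
... | yes refl = sym (⌊≟⌋-refl i)
... | no  i≢j  = sym (⌊≟⌋-≢ (λ j≡i → i≢j (sym j≡i)))

diagonal-sym : ∀ {m} (f : Fin m → ℚ) (i j : Fin m) → (if ⌊ i ≟ j ⌋ then f i else 0ℚ) ≡ (if ⌊ j ≟ i ⌋ then f j else 0ℚ)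
diagonal-sym f i j with i ≟ j
... | yes refl rewrite ⌊≟⌋-refl i = refl
... | no  i≢j  rewrite ⌊≟⌋-≢ (λ j≡i → i≢j (sym j≡i)) = refl

δ-sym : ∀ {m} (i j : Fin m) → δ i j ≡ δ j i
δ-sym i j = cong (if_then 1ℚ else 0ℚ) (⌊≟⌋-sym i j)

δ-suc : ∀ {m} (i j : Fin m) → δ (1+ i) (1+ j) ≡ δ i j
δ-suc i j = cong (if_then 1ℚ else 0ℚ) (⌊⌋-map′ (cong 1+) Data.Fin.Properties.suc-injective (i ≟ j))

Σ-δ : ∀ {m} (i : Fin m) (h : Fin m → ℚ) → Σ (λ k → δ i k * h k) ≡ h i
Σ-δ {suc m} 0F h = begin
  1ℚ * h 0F + Σ (λ k → 0ℚ * h (1+ k))  ≡⟨ cong (_+_ (1ℚ * h 0F)) (trans (Σ-cong (λ k → *-zeroˡ (h (1+ k)))) (Σ-const m 0ℚ)) ⟩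
  1ℚ * h 0F + fromℕ m * 0ℚ             ≡⟨ solve 2 (λ a b → con 1ℚ :* a :+ b :* con 0ℚ := a) refl (h 0F) (fromℕ m) ⟩
  h 0F                                  ∎
  where open ≡-Reasoning
Σ-δ {suc m} (1+ i) h = begin
  0ℚ * h 0F + Σ (λ k → δ (1+ i) (1+ k) * h (1+ k))  ≡⟨ cong (_+_ (0ℚ * h 0F)) (Σ-cong (λ k → cong (_* h (1+ k)) (δ-suc i k))) ⟩
  0ℚ * h 0F + Σ (λ k → δ i k * h (1+ k))            ≡⟨ cong (_+_ (0ℚ * h 0F)) (Σ-δ i (λ k → h (1+ k))) ⟩
  0ℚ * h 0F + h (1+ i)                              ≡⟨ solve 2 (λ a b → con 0ℚ :* a :+ b := b) refl (h 0F) (h (1+ i)) ⟩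
  h (1+ i)                                          ∎
  where open ≡-Reasoning

Σ-*ʳ : ∀ {m} c (f : Fin m → ℚ) → Σ (λ k → f k * c) ≡ Σ f * c
Σ-*ʳ c f = trans (Σ-cong (λ k → *-comm (f k) c)) (trans (Σ-*ˡ c f) (*-comm c (Σ f)))

Σ-except : ∀ {m} (j : Fin m) (f : Fin m → ℚ) → Σ (λ k → if ⌊ k ≟ j ⌋ then 0ℚ else f k) ≡ Σ f - f j
Σ-except j f = begin
  Σ (λ k → if ⌊ k ≟ j ⌋ then 0ℚ else f k)  ≡⟨ Σ-cong (λ k → trans (if-as-δ ⌊ k ≟ j ⌋ (f k)) (cong (λ d → f k - d * f k) (δ-sym k j))) ⟩
  Σ (λ k → f k - δ j k * f k)              ≡⟨ Σ-− f (λ k → δ j k * f k) ⟩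
  Σ f - Σ (λ k → δ j k * f k)              ≡⟨ cong (_-_ (Σ f)) (Σ-δ j f) ⟩
  Σ f - f j                                ∎
  where
  open ≡-Reasoning
  if-as-δ : ∀ b x → (if b then 0ℚ else x) ≡ x - (if b then 1ℚ else 0ℚ) * x
  if-as-δ true  x = solve 1 (λ x → con 0ℚ := x :- con 1ℚ :* x) refl x
  if-as-δ false x = solve 1 (λ x → x := x :- con 0ℚ :* x) refl x

infix 4 _≈ₘ_

_≈ₘ_ : ∀ {m} → Matrix m → Matrix m → Set
A ≈ₘ B = ∀ i j → A i j ≡ B i j

⊗-cong : ∀ {m} {A A′ B B′ : Matrix m} → A ≈ₘ A′ → B ≈ₘ B′ → A ⊗ B ≈ₘ A′ ⊗ B′
⊗-cong A≈A′ B≈B′ i j = Σ-cong (λ k → cong₂ _*_ (A≈A′ i k) (B≈B′ k j))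

⊗-assoc : ∀ {m} (A B C : Matrix m) → (A ⊗ B) ⊗ C ≈ₘ A ⊗ (B ⊗ C)
⊗-assoc A B C i j = begin
  Σ (λ k → Σ (λ l → A i l * B l k) * C k j)    ≡⟨ Σ-cong (λ k → sym (Σ-*ʳ (C k j) (λ l → A i l * B l k))) ⟩
  Σ (λ k → Σ (λ l → A i l * B l k * C k j))    ≡⟨ Σ-comm (λ k l → A i l * B l k * C k j) ⟩
  Σ (λ l → Σ (λ k → A i l * B l k * C k j))    ≡⟨ Σ-cong (λ l → trans (Σ-cong (λ k → *-assoc (A i l) (B l k) (C k j)))
                                                                      (Σ-*ˡ (A i l) (λ k → B l k * C k j))) ⟩
  Σ (λ l → A i l * Σ (λ k → B l k * C k j))    ∎
  where open ≡-Reasoning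

⊗-semigroup : ℕ → Semigroup 0ℓ 0ℓ
⊗-semigroup m = record
  { Carrier     = Matrix m
  ; _≈_         = _≈ₘ_
  ; _∙_         = _⊗_
  ; isSemigroup = record
    { isMagma = record
      { isEquivalence = record
        { refl  = λ i j → refl
        ; sym   = λ A≈B i j → sym (A≈B i j)
        ; trans = λ A≈B B≈C i j → trans (A≈B i j) (B≈C i j)
        }
      ; ∙-cong = ⊗-cong
      }
    ; assoc = ⊗-assoc
    }
  }

module GroupInverse {c ℓ} (S : Semigroup c ℓ) where
  open Semigroup S using (Carrier; _≈_; _∙_; assoc; ∙-congˡ; ∙-congʳ; setoid) renaming (sym to ≈-sym; trans to ≈-trans)
  open import Relation.Binary.Reasoning.Setoid setoid

  IsGroupInverseOf : Carrier → Carrier → Set ℓ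
  IsGroupInverseOf a x = (a ∙ x) ∙ a ≈ a × (x ∙ a) ∙ x ≈ x × a ∙ x ≈ x ∙ a

  unique : ∀ {a x y} → IsGroupInverseOf a x → IsGroupInverseOf a y → x ≈ y
  unique {a} {x} {y} (axa≈a , xax≈x , ax≈xa) (aya≈a , yay≈y , ay≈ya) = begin
    x            ≈⟨ xax≈x ⟨
    (x ∙ a) ∙ x  ≈⟨ assoc x a x ⟩
    x ∙ (a ∙ x)  ≈⟨ ∙-congˡ ax≈ay ⟩
    x ∙ (a ∙ y)  ≈⟨ assoc x a y ⟨
    (x ∙ a) ∙ y  ≈⟨ ∙-congʳ (≈-trans (≈-sym ax≈xa) (≈-trans ax≈ay ay≈ya)) ⟩
    (y ∙ a) ∙ y  ≈⟨ yay≈y ⟩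
    y            ∎
    where
    ax≈ay : a ∙ x ≈ a ∙ y
    ax≈ay = begin
      a ∙ x              ≈⟨ ∙-congʳ aya≈a ⟨
      ((a ∙ y) ∙ a) ∙ x  ≈⟨ assoc (a ∙ y) a x ⟩
      (a ∙ y) ∙ (a ∙ x)  ≈⟨ ∙-congʳ ay≈ya ⟩
      (y ∙ a) ∙ (a ∙ x)  ≈⟨ assoc y a (a ∙ x) ⟩
      y ∙ (a ∙ (a ∙ x))  ≈⟨ ∙-congˡ (≈-trans (∙-congˡ ax≈xa) (≈-sym (assoc a x a))) ⟩
      y ∙ ((a ∙ x) ∙ a)  ≈⟨ ∙-congˡ axa≈a ⟩
      y ∙ a              ≈⟨ ay≈ya ⟨
      a ∙ y              ∎

two : ℚ
two = + 2 / 1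

resist-cong : ∀ {m} {X Y : Matrix m} → X ≈ₘ Y → ∀ i j → resist X i j ≡ resist Y i j
resist-cong X≈Y i j = cong₂ (λ u v → u - two * v) (cong₂ _+_ (X≈Y i i) (X≈Y j j)) (X≈Y i j)

module ResistanceCriterion {m : ℕ} (L R : Matrix (suc m)) (τ : Fin (suc m) → ℚ)
  (L-sym : ∀ i j → L i j ≡ L j i) (L-rowsum : ∀ i → Σ (L i) ≡ 0ℚ)
  (R-sym : ∀ i j → R i j ≡ R j i) (R-diag : ∀ i → R i i ≡ 0ℚ)
  (L⊗R : ∀ i j → (L ⊗ R) i j ≡ τ i - two * δ i j) where

  open ≡-Reasoning

  μ : ℚ
  μ = 1/fromℕ-suc m

  rowMean : Fin (suc m) → ℚ
  rowMean i = μ * Σ (R i)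

  grandMean : ℚ
  grandMean = μ * Σ rowMean

  -- −½ Π R Π, written out entrywise.
  X : Matrix (suc m)
  X i j = -½ * ((R i j - rowMean i) + (grandMean - rowMean j))

  size-*-μ : ∀ x → fromℕ (suc m) * (μ * x) ≡ x
  size-*-μ x = begin
    fromℕ (suc m) * (μ * x)  ≡⟨ sym (*-assoc (fromℕ (suc m)) μ x) ⟩
    fromℕ (suc m) * μ * x    ≡⟨ cong (_* x) (fromℕ-suc-*-inverse m) ⟩
    1ℚ * x                   ≡⟨ *-identityˡ x ⟩
    x                        ∎

  L-colsum : ∀ j → Σ (λ k → L k j) ≡ 0ℚ
  L-colsum j = trans (Σ-cong (λ k → L-sym k j)) (L-rowsum j)

  L⊗rowMean : ∀ i → Σ (λ k → L i k * rowMean k) ≡ τ i - two * μ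
  L⊗rowMean i = begin
    Σ (λ k → L i k * (μ * Σ (R k)))          ≡⟨ Σ-cong (λ k → trans (solve 3 (λ l u s → l :* (u :* s) := u :* (l :* s)) refl (L i k) μ (Σ (R k)))
                                                                    (cong (μ *_) (sym (Σ-*ˡ (L i k) (R k))))) ⟩
    Σ (λ k → μ * Σ (λ l → L i k * R k l))    ≡⟨ Σ-*ˡ μ (λ k → Σ (λ l → L i k * R k l)) ⟩
    μ * Σ (λ k → Σ (λ l → L i k * R k l))    ≡⟨ cong (μ *_) (trans (Σ-comm (λ k l → L i k * R k l)) (Σ-cong (L⊗R i))) ⟩
    μ * Σ (λ l → τ i - two * δ i l)          ≡⟨ cong (μ *_) (Σ-− (λ _ → τ i) (λ l → two * δ i l)) ⟩
    μ * (Σ {suc m} (λ _ → τ i) - Σ (λ l → two * δ i l))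
      ≡⟨ cong₂ (λ u v → μ * (u - v)) (Σ-const (suc m) (τ i)) (trans (Σ-cong (λ l → *-comm two (δ i l))) (Σ-δ i (λ _ → two))) ⟩
    μ * (fromℕ (suc m) * τ i - two)          ≡⟨ solve 4 (λ u s t w → u :* (s :* t :- w) := s :* (u :* t) :- w :* u) refl μ (fromℕ (suc m)) (τ i) two ⟩
    fromℕ (suc m) * (μ * τ i) - two * μ      ≡⟨ cong (_- two * μ) (size-*-μ (τ i)) ⟩
    τ i - two * μ                            ∎

  L⊗X : ∀ i j → (L ⊗ X) i j ≡ δ i j - μ
  L⊗X i j = begin
    Σ (λ k → L i k * X k j)
      ≡⟨ Σ-cong (λ k → solve 6 (λ l r u v s w → l :* (con -½ :* ((r :- u) :+ (s :- v))) :=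
                                   con -½ :* (l :* r) :+ con ½ :* (l :* u) :+ con -½ :* (s :- v) :* l)
                                 refl (L i k) (R k j) (rowMean k) (rowMean j) grandMean μ) ⟩
    Σ (λ k → -½ * (L i k * R k j) + ½ * (L i k * rowMean k) + -½ * (grandMean - rowMean j) * L i k)
      ≡⟨ Σ-linear -½ ½ (-½ * (grandMean - rowMean j)) (λ k → L i k * R k j) (λ k → L i k * rowMean k) (L i) ⟩
    -½ * (L ⊗ R) i j + ½ * Σ (λ k → L i k * rowMean k) + -½ * (grandMean - rowMean j) * Σ (L i)
      ≡⟨ cong₂ (λ u v → -½ * u + ½ * v + -½ * (grandMean - rowMean j) * Σ (L i)) (L⊗R i j) (L⊗rowMean i) ⟩
    -½ * (τ i - two * δ i j) + ½ * (τ i - two * μ) + -½ * (grandMean - rowMean j) * Σ (L i)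
      ≡⟨ cong (λ z → -½ * (τ i - two * δ i j) + ½ * (τ i - two * μ) + -½ * (grandMean - rowMean j) * z) (L-rowsum i) ⟩
    -½ * (τ i - two * δ i j) + ½ * (τ i - two * μ) + -½ * (grandMean - rowMean j) * 0ℚ
      ≡⟨ solve 4 (λ t d u c → con -½ :* (t :- con two :* d) :+ con ½ :* (t :- con two :* u) :+ con -½ :* c :* con 0ℚ := d :- u)
                 refl (τ i) (δ i j) μ (grandMean - rowMean j) ⟩
    δ i j - μ ∎

  X-sym : ∀ i j → X i j ≡ X j i
  X-sym i j = trans (cong (λ r → -½ * ((r - rowMean i) + (grandMean - rowMean j))) (R-sym i j))
    (solve 4 (λ r u v s → con -½ :* ((r :- u) :+ (s :- v)) := con -½ :* ((r :- v) :+ (s :- u))) refl (R j i) (rowMean i) (rowMean j) grandMean)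

  X-rowsum : ∀ i → Σ (X i) ≡ 0ℚ
  X-rowsum i = begin
    Σ (X i)
      ≡⟨ Σ-cong (λ j → solve 4 (λ r u v s → con -½ :* ((r :- u) :+ (s :- v)) := con -½ :* r :+ con ½ :* v :+ con -½ :* (s :- u) :* con 1ℚ)
                                 refl (R i j) (rowMean i) (rowMean j) grandMean) ⟩
    Σ (λ j → -½ * R i j + ½ * rowMean j + -½ * (grandMean - rowMean i) * 1ℚ)
      ≡⟨ Σ-linear -½ ½ (-½ * (grandMean - rowMean i)) (R i) rowMean (λ _ → 1ℚ) ⟩
    -½ * Σ (R i) + ½ * Σ rowMean + -½ * (μ * Σ rowMean - μ * Σ (R i)) * Σ {suc m} (λ _ → 1ℚ)
      ≡⟨ cong (λ z → -½ * Σ (R i) + ½ * Σ rowMean + -½ * (μ * Σ rowMean - μ * Σ (R i)) * z) (Σ-const (suc m) 1ℚ) ⟩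
    -½ * Σ (R i) + ½ * Σ rowMean + -½ * (μ * Σ rowMean - μ * Σ (R i)) * (fromℕ (suc m) * 1ℚ)
      ≡⟨ solve 4 (λ a b u n → con -½ :* a :+ con ½ :* b :+ con -½ :* (u :* b :- u :* a) :* (n :* con 1ℚ) :=
                              con -½ :* a :+ con ½ :* b :+ con -½ :* (n :* (u :* (b :- a))))
                 refl (Σ (R i)) (Σ rowMean) μ (fromℕ (suc m)) ⟩
    -½ * Σ (R i) + ½ * Σ rowMean + -½ * (fromℕ (suc m) * (μ * (Σ rowMean - Σ (R i))))
      ≡⟨ cong (λ z → -½ * Σ (R i) + ½ * Σ rowMean + -½ * z) (size-*-μ (Σ rowMean - Σ (R i))) ⟩
    -½ * Σ (R i) + ½ * Σ rowMean + -½ * (Σ rowMean - Σ (R i))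
      ≡⟨ solve 2 (λ a b → con -½ :* a :+ con ½ :* b :+ con -½ :* (b :- a) := con 0ℚ) refl (Σ (R i)) (Σ rowMean) ⟩
    0ℚ ∎

  X⊗L : ∀ i j → (X ⊗ L) i j ≡ δ i j - μ
  X⊗L i j = begin
    Σ (λ k → X i k * L k j)  ≡⟨ Σ-cong (λ k → trans (*-comm (X i k) (L k j)) (cong₂ _*_ (L-sym k j) (X-sym i k))) ⟩
    (L ⊗ X) j i              ≡⟨ L⊗X j i ⟩
    δ j i - μ                ≡⟨ cong (_- μ) (δ-sym j i) ⟩
    δ i j - μ                ∎

  centring-fixes : ∀ {A Y : Matrix (suc m)} → (∀ i k → A i k ≡ δ i k - μ) → (∀ j → Σ (λ k → Y k j) ≡ 0ℚ) → A ⊗ Y ≈ₘ Y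
  centring-fixes {A} {Y} A≡δ-μ Y-colsum i j = begin
    Σ (λ k → A i k * Y k j)                          ≡⟨ Σ-cong (λ k → trans (cong (_* Y k j) (A≡δ-μ i k))
                                                           (solve 3 (λ d u y → (d :- u) :* y := d :* y :- u :* y) refl (δ i k) μ (Y k j))) ⟩
    Σ (λ k → δ i k * Y k j - μ * Y k j)              ≡⟨ Σ-− (λ k → δ i k * Y k j) (λ k → μ * Y k j) ⟩
    Σ (λ k → δ i k * Y k j) - Σ (λ k → μ * Y k j)    ≡⟨ cong₂ _-_ (Σ-δ i (λ k → Y k j)) (trans (Σ-*ˡ μ (λ k → Y k j)) (cong (μ *_) (Y-colsum j))) ⟩
    Y i j - μ * 0ℚ                                   ≡⟨ solve 2 (λ y u → y :- u :* con 0ℚ := y) refl (Y i j) μ ⟩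
    Y i j                                            ∎

  X-isGroupInverse : IsGroupInverse L X
  X-isGroupInverse = centring-fixes L⊗X L-colsum
                   , centring-fixes X⊗L (λ j → trans (Σ-cong (λ k → X-sym k j)) (X-rowsum j))
                   , λ i j → trans (L⊗X i j) (sym (X⊗L i j))

  resist-X : ∀ i j → resist X i j ≡ R i j
  resist-X i j = trans (cong₂ (λ a b → -½ * ((a - rowMean i) + (grandMean - rowMean i)) + -½ * ((b - rowMean j) + (grandMean - rowMean j)) - two * X i j)
                              (R-diag i) (R-diag j))
    (solve 4 (λ r u v s → con -½ :* ((con 0ℚ :- u) :+ (s :- u)) :+ con -½ :* ((con 0ℚ :- v) :+ (s :- v)) :- con two :* (con -½ :* ((r :- u) :+ (s :- v))) := r)
           refl (R i j) (rowMean i) (rowMean j) grandMean)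

resistance-criterion : ∀ {m} (L R : Matrix (suc m)) (τ : Fin (suc m) → ℚ) →
  (∀ i j → L i j ≡ L j i) → (∀ i → Σ (L i) ≡ 0ℚ) → (∀ i j → R i j ≡ R j i) → (∀ i → R i i ≡ 0ℚ) →
  (∀ i j → (L ⊗ R) i j ≡ τ i - two * δ i j) →
  (∃ λ X → IsGroupInverse L X) × (∀ Y → IsGroupInverse L Y → ∀ i j → resist Y i j ≡ R i j)
resistance-criterion {m} L R τ L-sym L-rowsum R-sym R-diag L⊗R =
  (X , X-isGroupInverse) , λ Y Y-isGroupInverse i j →
    trans (resist-cong (GroupInverse.unique (⊗-semigroup (suc m)) Y-isGroupInverse X-isGroupInverse) i j) (resist-X i j)
  where open ResistanceCriterion L R τ L-sym L-rowsum R-sym R-diag L⊗R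

-- A is the vertex a, and P stands for P ∖ {a}.
data Part : Set where
  A P Q N : Part

Part-cases : {C : Part → Set} → C A → C P → C Q → C N → ∀ s → C s
Part-cases cA cP cQ cN A = cA
Part-cases cA cP cQ cN P = cP
Part-cases cA cP cQ cN Q = cQ
Part-cases cA cP cQ cN N = cN

Marks : Set
Marks = Bool × Bool × Bool × Bool

-- (in P, in Q, is a, in N): the four tests in terms of which Graph.adj is defined.
marks : Part → Marks
marks A = true  , false , true  , false
marks P = true  , false , false , false
marks Q = false , true  , false , false
marks N = false , false , false , true

edge : Marks → Marks → Bool
edge (x₁ , x₂ , x₃ , x₄) (y₁ , y₂ , y₃ , y₄) = (x₁ ∧ y₂) ∨ (x₂ ∧ y₁) ∨ (x₃ ∧ y₄) ∨ (x₄ ∧ y₃)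

_~_ : Part → Part → Bool
s ~ t = edge (marks s) (marks t)

~-sym : ∀ s t → s ~ t ≡ t ~ s
~-sym = Part-cases (Part-cases refl refl refl refl) (Part-cases refl refl refl refl)
                   (Part-cases refl refl refl refl) (Part-cases refl refl refl refl)

𝟙 : Bool → ℚ
𝟙 true  = 1ℚ
𝟙 false = 0ℚ

module PartPolynomials where

  Poly : Set
  Poly = Polynomial 3

  p q n : Poly
  p = var 0F
  q = var (1+ 0F)
  n = var (1+ (1+ 0F))

  -- pq times the claimed resistance between distinct vertices in parts s and t;
  -- the scaling keeps every entry polynomial.
  scaledResistance : Part → Part → Poly
  scaledResistance A A = con 0ℚ
  scaledResistance A P = con two :* p
  scaledResistance A Q = p :+ q :- con 1ℚ
  scaledResistance A N = p :* q
  scaledResistance P P = con two :* p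
  scaledResistance P Q = p :+ q :- con 1ℚ
  scaledResistance P N = p :* (q :+ con two)
  scaledResistance Q Q = con two :* q
  scaledResistance Q N = q :* (p :+ con 1ℚ) :+ (p :- con 1ℚ)
  scaledResistance N N = con two :* p :* q
  scaledResistance P A = scaledResistance A P
  scaledResistance Q A = scaledResistance A Q
  scaledResistance N A = scaledResistance A N
  scaledResistance Q P = scaledResistance P Q
  scaledResistance N P = scaledResistance P N
  scaledResistance N Q = scaledResistance Q N

  sumOverParts : (Part → Poly) → Poly
  sumOverParts g = g A :+ (p :- con 1ℚ) :* g P :+ q :* g Q :+ n :* g N

  adjacency : Part → Part → Poly
  adjacency s t = con (𝟙 (s ~ t))

  degree : Part → Poly
  degree s = sumOverParts (adjacency s)

  neighbourSum : Part → Part → Poly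
  neighbourSum s t = sumOverParts (λ u → adjacency s u :* scaledResistance u t) :- adjacency s t :* scaledResistance t t

  -- Off the diagonal, the entry deg(s) R̃ᵢⱼ − neighbourSum s t of L R̃ must equal the
  -- diagonal entry plus 2pq. The case s = t = A cannot occur, a being a single vertex.
  laplacian-identity : ∀ env s t → ¬ (s ≡ A × t ≡ A) →
    ⟦ degree s :* scaledResistance s t :- neighbourSum s t ⟧ env ≡ ⟦ con two :* (p :* q) :- neighbourSum s s ⟧ env
  laplacian-identity env s t s,t≢A =
    prove env (degree s :* scaledResistance s t :- neighbourSum s t) (con two :* (p :* q) :- neighbourSum s s) (normal-forms s t s,t≢A)
    where
    normal-forms : ∀ s t → ¬ (s ≡ A × t ≡ A) →
      ⟦ degree s :* scaledResistance s t :- neighbourSum s t ⟧↓ env ≡ ⟦ con two :* (p :* q) :- neighbourSum s s ⟧↓ env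
    normal-forms = Part-cases (Part-cases (λ s,t≢A → ⊥-elim (s,t≢A (refl , refl))) (λ _ → refl) (λ _ → refl) (λ _ → refl))
                              (Part-cases (λ _ → refl) (λ _ → refl) (λ _ → refl) (λ _ → refl))
                              (Part-cases (λ _ → refl) (λ _ → refl) (λ _ → refl) (λ _ → refl))
                              (Part-cases (λ _ → refl) (λ _ → refl) (λ _ → refl) (λ _ → refl))

  scaledResistance-sym : ∀ s t → scaledResistance s t ≡ scaledResistance t s
  scaledResistance-sym = Part-cases (Part-cases refl refl refl refl) (Part-cases refl refl refl refl)
                                    (Part-cases refl refl refl refl) (Part-cases refl refl refl refl)

<ᵇ-true : ∀ {m n} → m ℕ.< n → (m ℕ.<ᵇ n) ≡ true
<ᵇ-true m<n = Equivalence.to T-≡ (ℕ.<⇒<ᵇ m<n)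

<ᵇ-false : ∀ {m n} → n ℕ.≤ m → (m ℕ.<ᵇ n) ≡ false
<ᵇ-false {m} {n} n≤m = ¬-not (λ m<n → ℕ.≤⇒≯ n≤m (ℕ.<ᵇ⇒< m n (Equivalence.from T-≡ m<n)))

module BipartiteWithStar (a b n : ℕ) where
  open Graph (suc a) (suc b) n
  open PartPolynomials using (scaledResistance; scaledResistance-sym; degree; neighbourSum; laplacian-identity)
  open ≡-Reasoning

  p̂ q̂ : ℚ
  p̂ = fromℕ (suc a)
  q̂ = fromℕ (suc b)

  env : Vec ℚ 3
  env = p̂ ∷ q̂ ∷ fromℕ n ∷ []

  partℕ : ℕ → Part
  partℕ zero    = A
  partℕ (suc k) = if k ℕ.<ᵇ a then P else if k ℕ.<ᵇ a +ℕ suc b then Q else N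

  part : Fin V → Part
  part i = partℕ (toℕ i)

  partℕ-P : ∀ k → 1 ℕ.≤ k → k ℕ.< suc a → partℕ k ≡ P
  partℕ-P (suc k) _ (ℕ.s≤s k<a) rewrite <ᵇ-true k<a = refl

  partℕ-Q : ∀ k → suc a ℕ.≤ k → k ℕ.< suc a +ℕ suc b → partℕ k ≡ Q
  partℕ-Q (suc k) (ℕ.s≤s a≤k) (ℕ.s≤s k<a+q) rewrite <ᵇ-false a≤k | <ᵇ-true k<a+q = refl

  partℕ-N : ∀ k → suc a +ℕ suc b ℕ.≤ k → partℕ k ≡ N
  partℕ-N (suc k) (ℕ.s≤s a+q≤k) rewrite <ᵇ-false (ℕ.≤-trans (ℕ.m≤m+n a (suc b)) a+q≤k) | <ᵇ-false a+q≤k = refl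

  A'⇒A : ∀ {i} → A' i → part i ≡ A
  A'⇒A i≡0 = cong partℕ i≡0

  P'⇒P : ∀ {i} → P' i → part i ≡ P
  P'⇒P {i} (1≤i , i<p) = partℕ-P (toℕ i) 1≤i i<p

  Q'⇒Q : ∀ {i} → Q' i → part i ≡ Q
  Q'⇒Q {i} (p≤i , i<p+q) = partℕ-Q (toℕ i) p≤i i<p+q

  N'⇒N : ∀ {i} → N' i → part i ≡ N
  N'⇒N {i} p+q≤i = partℕ-N (toℕ i) p+q≤i

  part≡A⇒A' : ∀ i → part i ≡ A → A' i
  part≡A⇒A' i = go (toℕ i)
    where
    go : ∀ k → partℕ k ≡ A → k ≡ 0
    go zero    _ = refl
    go (suc k) eq with k ℕ.<ᵇ a | k ℕ.<ᵇ a +ℕ suc b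
    go (suc k) () | true  | _
    go (suc k) () | false | true
    go (suc k) () | false | false

  vertexMarks : Fin V → Marks
  vertexMarks i = isP i , isQ i , isA i , isN i

  vertexMarks-part : ∀ i → vertexMarks i ≡ marks (part i)
  vertexMarks-part i = go (toℕ i)
    where
    go : ∀ k → ((k ℕ.<ᵇ suc a) , (not (k ℕ.<ᵇ suc a) ∧ (k ℕ.<ᵇ suc a +ℕ suc b)) , (k ℕ.≡ᵇ 0) , not (k ℕ.<ᵇ suc a +ℕ suc b))
             ≡ marks (partℕ k)
    go zero = refl
    go (suc k) with k ℕ.<? a | k ℕ.<? a +ℕ suc b
    ... | yes k<a | _ rewrite <ᵇ-true k<a | <ᵇ-true (ℕ.<-≤-trans k<a (ℕ.m≤m+n a (suc b))) = refl
    ... | no  k≮a | yes k<a+q rewrite <ᵇ-false (ℕ.≮⇒≥ k≮a) | <ᵇ-true k<a+q = refl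
    ... | no  k≮a | no  k≮a+q rewrite <ᵇ-false (ℕ.≮⇒≥ k≮a) | <ᵇ-false (ℕ.≮⇒≥ k≮a+q) = refl

  adj-part : ∀ i k → adj i k ≡ part i ~ part k
  adj-part i k = cong₂ edge (vertexMarks-part i) (vertexMarks-part k)

  fromℕa≡p̂-1 : fromℕ a ≡ p̂ - 1ℚ
  fromℕa≡p̂-1 = begin
    fromℕ a               ≡⟨ solve 1 (λ x → x := con 1ℚ :+ x :- con 1ℚ) refl (fromℕ a) ⟩
    1ℚ + fromℕ a - 1ℚ     ≡⟨ cong (_- 1ℚ) (sym (fromℕ-+ 1 a)) ⟩
    p̂ - 1ℚ                ∎

  Σ-over-parts : ∀ (g : Part → ℚ) → Σ (λ i → g (part i)) ≡ g A + (p̂ - 1ℚ) * g P + q̂ * g Q + fromℕ n * g N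
  Σ-over-parts g = begin
    g A + Σ {a +ℕ suc b +ℕ n} (λ i → h (toℕ i))
      ≡⟨ cong (_+_ (g A)) (trans (Σ-split (a +ℕ suc b) n h) (cong (_+ Σ {n} (λ k → h (a +ℕ suc b +ℕ toℕ k))) (Σ-split a (suc b) h))) ⟩
    g A + (Σ {a} (λ i → h (toℕ i)) + Σ {suc b} (λ j → h (a +ℕ toℕ j)) + Σ {n} (λ k → h (a +ℕ suc b +ℕ toℕ k)))
      ≡⟨ cong (_+_ (g A)) (cong₂ _+_ (cong₂ _+_ (Σ-constant {a} (λ i → h (toℕ i)) (g P) (λ i → cong g (partℕ-P _ (ℕ.s≤s ℕ.z≤n) (ℕ.s≤s (toℕ<n i)))))
                                                 (Σ-constant {suc b} (λ j → h (a +ℕ toℕ j)) (g Q) (λ j → cong g (partℕ-Q _ (ℕ.s≤s (ℕ.m≤m+n a (toℕ j))) (ℕ.s≤s (ℕ.+-monoʳ-< a (toℕ<n j)))))))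
                                     (Σ-constant {n} (λ k → h (a +ℕ suc b +ℕ toℕ k)) (g N) (λ k → cong g (partℕ-N _ (ℕ.s≤s (ℕ.m≤m+n (a +ℕ suc b) (toℕ k))))))) ⟩
    g A + (fromℕ a * g P + q̂ * g Q + fromℕ n * g N)
      ≡⟨ cong (λ x → g A + (x * g P + q̂ * g Q + fromℕ n * g N)) fromℕa≡p̂-1 ⟩
    g A + ((p̂ - 1ℚ) * g P + q̂ * g Q + fromℕ n * g N)
      ≡⟨ solve 4 (λ w x y z → w :+ (x :+ y :+ z) := w :+ x :+ y :+ z) refl (g A) ((p̂ - 1ℚ) * g P) (q̂ * g Q) (fromℕ n * g N) ⟩
    g A + (p̂ - 1ℚ) * g P + q̂ * g Q + fromℕ n * g N ∎
    where
    h : ℕ → ℚ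
    h k = g (partℕ (suc k))

  b2q≡𝟙 : ∀ x → b2q x ≡ 𝟙 x
  b2q≡𝟙 true  = refl
  b2q≡𝟙 false = refl

  b2q-adj : ∀ i k → b2q (adj i k) ≡ 𝟙 (part i ~ part k)
  b2q-adj i k = trans (b2q≡𝟙 (adj i k)) (cong 𝟙 (adj-part i k))

  deg-part : ∀ i → deg i ≡ ⟦ degree (part i) ⟧ env
  deg-part i = trans (Σ-cong (b2q-adj i)) (Σ-over-parts (λ u → 𝟙 (part i ~ u)))

  Lap-action : ∀ (y : Fin V → ℚ) i → Σ (λ k → Lap i k * y k) ≡ deg i * y i - Σ (λ k → b2q (adj i k) * y k)
  Lap-action y i = begin
    Σ (λ k → Lap i k * y k)
      ≡⟨ Σ-cong (λ k → trans (cong (λ d → (d - b2q (adj i k)) * y k) (diagonal-as-δ ⌊ i ≟ k ⌋))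
                             (solve 4 (λ x d b y → (x :* d :- b) :* y := x :* (d :* y) :- b :* y) refl (deg i) (δ i k) (b2q (adj i k)) (y k))) ⟩
    Σ (λ k → deg i * (δ i k * y k) - b2q (adj i k) * y k)
      ≡⟨ Σ-− (λ k → deg i * (δ i k * y k)) (λ k → b2q (adj i k) * y k) ⟩
    Σ (λ k → deg i * (δ i k * y k)) - Σ (λ k → b2q (adj i k) * y k)
      ≡⟨ cong (_- Σ (λ k → b2q (adj i k) * y k)) (trans (Σ-*ˡ (deg i) (λ k → δ i k * y k)) (cong (deg i *_) (Σ-δ i y))) ⟩
    deg i * y i - Σ (λ k → b2q (adj i k) * y k) ∎
    where
    diagonal-as-δ : ∀ c → (if c then deg i else 0ℚ) ≡ deg i * (if c then 1ℚ else 0ℚ)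
    diagonal-as-δ true  = sym (*-identityʳ (deg i))
    diagonal-as-δ false = sym (*-zeroʳ (deg i))

  Lap-rowsum : ∀ i → Σ (Lap i) ≡ 0ℚ
  Lap-rowsum i = begin
    Σ (Lap i)                                    ≡⟨ Σ-cong (λ k → sym (*-identityʳ (Lap i k))) ⟩
    Σ (λ k → Lap i k * 1ℚ)                       ≡⟨ Lap-action (λ _ → 1ℚ) i ⟩
    deg i * 1ℚ - Σ (λ k → b2q (adj i k) * 1ℚ)    ≡⟨ cong (_-_ (deg i * 1ℚ)) (Σ-cong (λ k → *-identityʳ (b2q (adj i k)))) ⟩
    deg i * 1ℚ - deg i                           ≡⟨ solve 1 (λ d → d :* con 1ℚ :- d := con 0ℚ) refl (deg i) ⟩
    0ℚ                                           ∎

  Lap-sym : ∀ i j → Lap i j ≡ Lap j i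
  Lap-sym i j = cong₂ _-_ (diagonal-sym deg i j) (cong b2q adj-sym)
    where
    adj-sym : adj i j ≡ adj j i
    adj-sym = trans (adj-part i j) (trans (~-sym (part i) (part j)) (sym (adj-part j i)))

  r : Part → Part → ℚ
  r s t = ⟦ scaledResistance s t ⟧ env

  R̃ : Matrix V
  R̃ i j = if ⌊ i ≟ j ⌋ then 0ℚ else r (part i) (part j)

  τ̃ : Part → ℚ
  τ̃ s = two * (p̂ * q̂) - ⟦ neighbourSum s s ⟧ env

  neighbourSum-part : ∀ i j → Σ (λ k → b2q (adj i k) * R̃ k j) ≡ ⟦ neighbourSum (part i) (part j) ⟧ env
  neighbourSum-part i j = begin
    Σ (λ k → b2q (adj i k) * R̃ k j)                     ≡⟨ Σ-cong (λ k → trans (cong (_* R̃ k j) (b2q-adj i k)) (*-outside k ⌊ k ≟ j ⌋)) ⟩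
    Σ (λ k → if ⌊ k ≟ j ⌋ then 0ℚ else f (part k))       ≡⟨ Σ-except j (λ k → f (part k)) ⟩
    Σ (λ k → f (part k)) - f (part j)                    ≡⟨ cong (_- f (part j)) (Σ-over-parts f) ⟩
    ⟦ neighbourSum (part i) (part j) ⟧ env               ∎
    where
    f : Part → ℚ
    f u = 𝟙 (part i ~ u) * r u (part j)
    *-outside : ∀ k c → 𝟙 (part i ~ part k) * (if c then 0ℚ else r (part k) (part j)) ≡ (if c then 0ℚ else f (part k))
    *-outside k true  = *-zeroʳ (𝟙 (part i ~ part k))
    *-outside k false = refl

  distinct⇒not-both-A : ∀ {i j} → i ≢ j → ¬ (part i ≡ A × part j ≡ A)
  distinct⇒not-both-A {i} {j} i≢j (i∈A , j∈A) = i≢j (toℕ-injective (trans (part≡A⇒A' i i∈A) (sym (part≡A⇒A' j j∈A))))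

  Lap⊗R̃ : ∀ i j → (Lap ⊗ R̃) i j ≡ τ̃ (part i) - two * (p̂ * q̂) * δ i j
  Lap⊗R̃ i j = begin
    (Lap ⊗ R̃) i j                                                   ≡⟨ Lap-action (λ k → R̃ k j) i ⟩
    deg i * R̃ i j - Σ (λ k → b2q (adj i k) * R̃ k j)                 ≡⟨ cong₂ (λ d x → d * R̃ i j - x) (deg-part i) (neighbourSum-part i j) ⟩
    ⟦ degree (part i) ⟧ env * R̃ i j - ⟦ neighbourSum (part i) (part j) ⟧ env  ≡⟨ on-and-off-diagonal (i ≟ j) ⟩
    τ̃ (part i) - two * (p̂ * q̂) * δ i j                               ∎
    where
    on-and-off-diagonal : (i≟j : Dec (i ≡ j)) →
      ⟦ degree (part i) ⟧ env * (if ⌊ i≟j ⌋ then 0ℚ else r (part i) (part j)) - ⟦ neighbourSum (part i) (part j) ⟧ env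
        ≡ τ̃ (part i) - two * (p̂ * q̂) * (if ⌊ i≟j ⌋ then 1ℚ else 0ℚ)
    on-and-off-diagonal (yes refl) =
      solve 3 (λ d x c → d :* con 0ℚ :- x := (con two :* c :- x) :- con two :* c :* con 1ℚ) refl
              (⟦ degree (part i) ⟧ env) (⟦ neighbourSum (part i) (part i) ⟧ env) (p̂ * q̂)
    on-and-off-diagonal (no i≢j) = trans (laplacian-identity env (part i) (part j) (distinct⇒not-both-A i≢j))
      (solve 2 (λ x c → x := x :- con two :* c :* con 0ℚ) refl (τ̃ (part i)) (p̂ * q̂))

  -- 1 / (p q), since suc a * suc b reduces to suc (b + a * suc b).
  κ : ℚ
  κ = 1/fromℕ-suc (b +ℕ a *ℕ suc b)

  p̂q̂κ≡1 : p̂ * q̂ * κ ≡ 1ℚ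
  p̂q̂κ≡1 = trans (cong (_* κ) (sym (fromℕ-* (suc a) (suc b)))) (fromℕ-suc-*-inverse (b +ℕ a *ℕ suc b))

  R : Matrix V
  R i j = κ * R̃ i j

  τ : Fin V → ℚ
  τ i = κ * τ̃ (part i)

  Lap⊗R : ∀ i j → (Lap ⊗ R) i j ≡ τ i - two * δ i j
  Lap⊗R i j = begin
    Σ (λ k → Lap i k * (κ * R̃ k j))                 ≡⟨ Σ-cong (λ k → solve 3 (λ l u x → l :* (u :* x) := u :* (l :* x)) refl (Lap i k) κ (R̃ k j)) ⟩
    Σ (λ k → κ * (Lap i k * R̃ k j))                 ≡⟨ Σ-*ˡ κ (λ k → Lap i k * R̃ k j) ⟩
    κ * (Lap ⊗ R̃) i j                               ≡⟨ cong (κ *_) (Lap⊗R̃ i j) ⟩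
    κ * (τ̃ (part i) - two * (p̂ * q̂) * δ i j)        ≡⟨ solve 4 (λ u t c d → u :* (t :- con two :* c :* d) := u :* t :- con two :* (c :* u) :* d)
                                                               refl κ (τ̃ (part i)) (p̂ * q̂) (δ i j) ⟩
    τ i - two * (p̂ * q̂ * κ) * δ i j                 ≡⟨ cong (λ x → τ i - two * x * δ i j) p̂q̂κ≡1 ⟩
    τ i - two * 1ℚ * δ i j                          ≡⟨ solve 2 (λ t d → t :- con two :* con 1ℚ :* d := t :- con two :* d) refl (τ i) (δ i j) ⟩
    τ i - two * δ i j                               ∎

  R-sym : ∀ i j → R i j ≡ R j i
  R-sym i j = cong (κ *_) (cong₂ (if_then 0ℚ else_) (⌊≟⌋-sym i j) (cong (λ e → ⟦ e ⟧ env) (scaledResistance-sym (part i) (part j))))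

  R-diag : ∀ i → R i i ≡ 0ℚ
  R-diag i = trans (cong (λ c → κ * (if c then 0ℚ else r (part i) (part i))) (⌊≟⌋-refl i)) (*-zeroʳ κ)

  R-off-diagonal : ∀ {i j} → i ≢ j → R i j ≡ κ * r (part i) (part j)
  R-off-diagonal {i} {j} i≢j = cong (λ c → κ * (if c then 0ℚ else r (part i) (part j))) (⌊≟⌋-≢ i≢j)

  resistances : (∃ λ X → IsGroupInverse Lap X) × (∀ X → IsGroupInverse Lap X → ∀ i j → resist X i j ≡ R i j)
  resistances = resistance-criterion Lap R τ Lap-sym Lap-rowsum R-sym R-diag Lap⊗R

  resist-distinct : ∀ X → IsGroupInverse Lap X → ∀ {i j} → i ≢ j → resist X i j ≡ κ * r (part i) (part j)
  resist-distinct X X-inv {i} {j} i≢j = trans (proj₂ resistances X X-inv i j) (R-off-diagonal i≢j)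

  resist-within : ∀ {S : Fin V → Set} {s v} → (∀ {i} → S i → part i ≡ s) →
                  κ * r s s ≡ v → ∀ X → IsGroupInverse Lap X → ∀ i j → S i → S j → i ≢ j → resist X i j ≡ v
  resist-within S⇒s κr≡v X X-inv i j i∈S j∈S i≢j =
    trans (resist-distinct X X-inv i≢j) (trans (cong₂ (λ u w → κ * r u w) (S⇒s i∈S) (S⇒s j∈S)) κr≡v)

  resist-across : ∀ {S T : Fin V → Set} {s t v} → (∀ {i} → S i → part i ≡ s) → (∀ {j} → T j → part j ≡ t) → s ≢ t →
                  κ * r s t ≡ v → ∀ X → IsGroupInverse Lap X → ∀ i j → S i → T j → resist X i j ≡ v
  resist-across S⇒s T⇒t s≢t κr≡v X X-inv i j i∈S j∈T =
    trans (resist-distinct X X-inv i≢j) (trans (cong₂ (λ u w → κ * r u w) (S⇒s i∈S) (T⇒t j∈T)) κr≡v)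
    where
    i≢j : i ≢ j
    i≢j i≡j = s≢t (trans (sym (S⇒s i∈S)) (trans (cong part i≡j) (T⇒t j∈T)))

  scaled-value : ∀ k d x y → x * fromℕ (suc d) ≡ p̂ * q̂ * y → fromℕ k ≡ y → κ * x ≡ + k / suc d
  scaled-value k d x y x*d≡pqy k≡y = /-unique k d (κ * x) (begin
    κ * x * fromℕ (suc d)      ≡⟨ *-assoc κ x (fromℕ (suc d)) ⟩
    κ * (x * fromℕ (suc d))    ≡⟨ cong (κ *_) x*d≡pqy ⟩
    κ * (p̂ * q̂ * y)            ≡⟨ solve 4 (λ u p q y → u :* (p :* q :* y) := p :* q :* u :* y) refl κ p̂ q̂ y ⟩
    p̂ * q̂ * κ * y              ≡⟨ cong (_* y) p̂q̂κ≡1 ⟩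
    1ℚ * y                     ≡⟨ *-identityˡ y ⟩
    y                          ≡⟨ sym k≡y ⟩
    fromℕ k                    ∎)

  *-fromℕ-pq : ∀ x → x * fromℕ (suc a *ℕ suc b) ≡ p̂ * q̂ * x
  *-fromℕ-pq x = trans (cong (x *_) (fromℕ-* (suc a) (suc b))) (*-comm x (p̂ * q̂))

  2p/pq≡2/q : κ * (two * p̂) ≡ + 2 / suc b
  2p/pq≡2/q = scaled-value 2 b (two * p̂) two (solve 3 (λ t p q → t :* p :* q := p :* q :* t) refl two p̂ q̂) refl

  2q/pq≡2/p : κ * (two * q̂) ≡ + 2 / suc a
  2q/pq≡2/p = scaled-value 2 a (two * q̂) two (solve 3 (λ t p q → t :* q :* p := p :* q :* t) refl two p̂ q̂) refl

  2pq/pq≡2 : κ * (two * p̂ * q̂) ≡ + 2 / 1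
  2pq/pq≡2 = scaled-value 2 0 (two * p̂ * q̂) two (solve 3 (λ t p q → t :* p :* q :* con 1ℚ := p :* q :* t) refl two p̂ q̂) refl

  pq/pq≡1 : κ * (p̂ * q̂) ≡ 1ℚ
  pq/pq≡1 = trans (*-comm κ (p̂ * q̂)) p̂q̂κ≡1

  p[q+2]/pq≡[q+2]/q : κ * (p̂ * (q̂ + two)) ≡ + (suc b +ℕ 2) / suc b
  p[q+2]/pq≡[q+2]/q = scaled-value (suc b +ℕ 2) b (p̂ * (q̂ + two)) (q̂ + two)
    (solve 3 (λ p q t → p :* (q :+ t) :* q := p :* q :* (q :+ t)) refl p̂ q̂ two) (fromℕ-+ (suc b) 2)

  [p+q-1]/pq≡[p+q∸1]/pq : κ * (p̂ + q̂ - 1ℚ) ≡ (suc a +ℕ suc b ∸ 1) /[ suc a * suc b ]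
  [p+q-1]/pq≡[p+q∸1]/pq = scaled-value (a +ℕ suc b) (b +ℕ a *ℕ suc b) (p̂ + q̂ - 1ℚ) (p̂ + q̂ - 1ℚ) (*-fromℕ-pq (p̂ + q̂ - 1ℚ)) (begin
    fromℕ (a +ℕ suc b)    ≡⟨ fromℕ-+ a (suc b) ⟩
    fromℕ a + q̂           ≡⟨ cong (_+ q̂) fromℕa≡p̂-1 ⟩
    p̂ - 1ℚ + q̂            ≡⟨ solve 2 (λ p q → p :- con 1ℚ :+ q := p :+ q :- con 1ℚ) refl p̂ q̂ ⟩
    p̂ + q̂ - 1ℚ            ∎)

  [q[p+1]+p-1]/pq≡[q[p+1]+p∸1]/pq : κ * (q̂ * (p̂ + 1ℚ) + (p̂ - 1ℚ)) ≡ (suc b *ℕ (suc a +ℕ 1) +ℕ (suc a ∸ 1)) /[ suc a * suc b ]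
  [q[p+1]+p-1]/pq≡[q[p+1]+p∸1]/pq =
    scaled-value (suc b *ℕ (suc a +ℕ 1) +ℕ a) (b +ℕ a *ℕ suc b) (q̂ * (p̂ + 1ℚ) + (p̂ - 1ℚ)) (q̂ * (p̂ + 1ℚ) + (p̂ - 1ℚ))
      (*-fromℕ-pq (q̂ * (p̂ + 1ℚ) + (p̂ - 1ℚ))) (begin
    fromℕ (suc b *ℕ (suc a +ℕ 1) +ℕ a)          ≡⟨ fromℕ-+ (suc b *ℕ (suc a +ℕ 1)) a ⟩
    fromℕ (suc b *ℕ (suc a +ℕ 1)) + fromℕ a     ≡⟨ cong₂ _+_ (trans (fromℕ-* (suc b) (suc a +ℕ 1)) (cong (q̂ *_) (fromℕ-+ (suc a) 1))) fromℕa≡p̂-1 ⟩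
    q̂ * (p̂ + 1ℚ) + (p̂ - 1ℚ)                     ∎)

theorem3p4 : (p q n : ℕ) → .{{_ : NonZero p}} → .{{_ : NonZero q}} → .{{_ : NonZero n}} →
    let open Graph p q n in
    (∃ λ X → IsGroupInverse Lap X) ×
    (∀ X → IsGroupInverse Lap X →
      (∀ a x → A' a → P' x → resist X a x ≡ + 2 / q) ×
      (∀ a y → A' a → Q' y → resist X a y ≡ (p +ℕ q ∸ 1) /[ p * q ]) ×
      (∀ a z → A' a → N' z → resist X a z ≡ 1ℚ) ×
      (∀ x x′ → P' x → P' x′ → x ≢ x′ → resist X x x′ ≡ + 2 / q) ×
      (∀ x y → P' x → Q' y → resist X x y ≡ (p +ℕ q ∸ 1) /[ p * q ]) ×
      (∀ x z → P' x → N' z → resist X x z ≡ + (q +ℕ 2) / q) ×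
      (∀ y y′ → Q' y → Q' y′ → y ≢ y′ → resist X y y′ ≡ + 2 / p) ×
      (∀ y z → Q' y → N' z → resist X y z ≡ (q *ℕ (p +ℕ 1) +ℕ (p ∸ 1)) /[ p * q ]) ×
      (∀ z z′ → N' z → N' z′ → z ≢ z′ → resist X z z′ ≡ + 2 / 1))
theorem3p4 zero    q       n {{p≢0}}         = ⊥-elim-irr (NonZero.nonZero p≢0)
theorem3p4 (suc a) zero    n {{_}} {{q≢0}}   = ⊥-elim-irr (NonZero.nonZero q≢0)
theorem3p4 (suc a) (suc b) n = proj₁ resistances , λ X X-inv →
    resist-across A'⇒A P'⇒P (λ ()) 2p/pq≡2/q X X-inv
  , resist-across A'⇒A Q'⇒Q (λ ()) [p+q-1]/pq≡[p+q∸1]/pq X X-inv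
  , resist-across A'⇒A N'⇒N (λ ()) pq/pq≡1 X X-inv
  , resist-within P'⇒P 2p/pq≡2/q X X-inv
  , resist-across P'⇒P Q'⇒Q (λ ()) [p+q-1]/pq≡[p+q∸1]/pq X X-inv
  , resist-across P'⇒P N'⇒N (λ ()) p[q+2]/pq≡[q+2]/q X X-inv
  , resist-within Q'⇒Q 2q/pq≡2/p X X-inv
  , resist-across Q'⇒Q N'⇒N (λ ()) [q[p+1]+p-1]/pq≡[q[p+1]+p∸1]/pq X X-inv
  , resist-within N'⇒N 2pq/pq≡2 X X-inv
  where open BipartiteWithStar a b n
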